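{- For functions $g,h:\omega\to\omega$, if $h\le_{\mathrm{ubfb}} g$ then $h\le_{\mathrm{wcf}} g$.
   Context: $h\le_{\mathrm{ubfb}} g$ means $h=\Phi^g$ for some Turing functional $\Phi$ such that the least argument at which $g$ is queried during the computation of $\Phi^g(n)$ tends to infinity with $n$. A weak cofinite description of $g$ is a partial function $f$ such that $f(n)$ is defined and equals $g(n)$ for all but finitely many $n$. An enumeration operator is a c.e. set $W$ of pairs $(F,k)$, $F$ finite, with $W^Y=\{k:\exists(F,k)\in W,\,F\subseteq Y\}$. $h\le_{\mathrm{wcf}} g$ means there is an enumeration operator $W$ such that for every weak cofinite description $f$ of $g$, $W^{\mathrm{gra}(f)}$ is the graph of a weak cofinite description of $h$. -}

module Defs where

open import Data.Nat using (ℕ; zero; suc; _+_; _≤_)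
open import Data.Fin using (Fin)
open import Data.Vec using (Vec; []; _∷_; lookup)
open import Data.List using (List; []; _∷_; _++_)
open import Data.List.Relation.Unary.All using (All)
open import Data.Product using (Σ; ∃; _×_; _,_; proj₁; proj₂)
open import Relation.Binary.PropositionalEquality using (_≡_)

-- Model of computation: partial recursive (μ-recursive) functions
-- relative to an oracle g : ℕ → ℕ.  'Code n' is the syntax of n-ary
-- programs; 'orc' queries the oracle at its argument.

data Code : ℕ → Set where
  zer  : ∀ {n} → Code n
  succ : Code 1
  proj : ∀ {n} → Fin n → Code n
  comp : ∀ {m n} → Code m → Vec (Code n) m → Code n
  prec : ∀ {n} → Code n → Code (suc (suc n)) → Code (suc n)
  mu   : ∀ {n} → Code (suc n) → Code n
  orc  : Code 1

-- Big-step semantics: 'Eval g c xs v qs' means that the program c on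
-- input xs with oracle g halts with output v, and qs is the list of all
-- arguments at which the oracle was queried during the computation.
data Eval (g : ℕ → ℕ) : ∀ {n} → Code n → Vec ℕ n → ℕ → List ℕ → Set
data EvalVec (g : ℕ → ℕ) : ∀ {m n} → Vec (Code n) m → Vec ℕ n → Vec ℕ m → List ℕ → Set
data MuSearch (g : ℕ → ℕ) {n : ℕ} (f : Code (suc n)) (xs : Vec ℕ n) : ℕ → ℕ → List ℕ → Set

data Eval g where
  ezer  : ∀ {n} {xs : Vec ℕ n} → Eval g zer xs 0 []
  esucc : ∀ {x} → Eval g succ (x ∷ []) (suc x) []
  eproj : ∀ {n} {xs : Vec ℕ n} {i : Fin n} → Eval g (proj i) xs (lookup xs i) []
  ecomp : ∀ {m n} {f : Code m} {cs : Vec (Code n) m} {xs ys v qs qs'} →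
          EvalVec g cs xs ys qs → Eval g f ys v qs' →
          Eval g (comp f cs) xs v (qs ++ qs')
  eprec0 : ∀ {n} {f : Code n} {h : Code (suc (suc n))} {xs v qs} →
           Eval g f xs v qs → Eval g (prec f h) (0 ∷ xs) v qs
  eprecS : ∀ {n} {f : Code n} {h : Code (suc (suc n))} {xs y r v qs qs'} →
           Eval g (prec f h) (y ∷ xs) r qs → Eval g h (y ∷ r ∷ xs) v qs' →
           Eval g (prec f h) (suc y ∷ xs) v (qs ++ qs')
  emu   : ∀ {n} {f : Code (suc n)} {xs k qs} →
          MuSearch g f xs 0 k qs → Eval g (mu f) xs k qs
  eorc  : ∀ {x} → Eval g orc (x ∷ []) (g x) (x ∷ [])

data EvalVec g where
  []  : ∀ {n} {xs : Vec ℕ n} → EvalVec g [] xs [] []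
  _∷_ : ∀ {m n} {c : Code n} {cs : Vec (Code n) m} {xs y ys qs qs'} →
        Eval g c xs y qs → EvalVec g cs xs ys qs' →
        EvalVec g (c ∷ cs) xs (y ∷ ys) (qs ++ qs')

data MuSearch g f xs where
  found : ∀ {i qs} → Eval g f (i ∷ xs) 0 qs → MuSearch g f xs i i qs
  step  : ∀ {i v k qs qs'} → Eval g f (i ∷ xs) (suc v) qs →
          MuSearch g f xs (suc i) k qs' → MuSearch g f xs i k (qs ++ qs')

TuringFunctional : Set
TuringFunctional = Code 1

Computes : TuringFunctional → (ℕ → ℕ) → (ℕ → ℕ) → Set
Computes Φ g h = ∀ n → ∃ λ qs → Eval g Φ (n ∷ []) (h n) qs

UseTendsToInfinity : TuringFunctional → (ℕ → ℕ) → (ℕ → ℕ) → Set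
UseTendsToInfinity Φ g h =
  ∀ M → ∃ λ N → ∀ n → N ≤ n → ∀ qs → Eval g Φ (n ∷ []) (h n) qs → All (M ≤_) qs

_≤ubfb_ : (ℕ → ℕ) → (ℕ → ℕ) → Set
h ≤ubfb g = Σ TuringFunctional λ Φ → Computes Φ g h × UseTendsToInfinity Φ g h

-- Coding of finite objects as natural numbers (Cantor pairing).

tri : ℕ → ℕ
tri zero    = zero
tri (suc k) = suc k + tri k

pair : ℕ → ℕ → ℕ
pair a b = tri (a + b) + b

codePair : ℕ × ℕ → ℕ
codePair (a , b) = pair a b

-- finite sets of pairs are given by (finite) lists of pairs
codeList : List (ℕ × ℕ) → ℕ
codeList []       = 0
codeList (p ∷ ps) = suc (pair (codePair p) (codeList ps))

-- e halts on input x (without oracle; the constant-0 oracle is computable,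
-- so this is ordinary partial computability)
Halts : Code 1 → ℕ → Set
Halts e x = ∃ λ v → ∃ λ qs → Eval (λ _ → 0) e (x ∷ []) v qs

-- An enumeration operator is a c.e. set W of pairs (F, k), F a finite
-- subset of ℕ × ℕ (as we apply it to graphs) and k ∈ ℕ × ℕ; W is given by
-- an index e, with (F , k) ∈ W iff e halts on the code of (F , k).
EnumOp : Set
EnumOp = Code 1

_∈W_ : List (ℕ × ℕ) × (ℕ × ℕ) → EnumOp → Set
(F , k) ∈W W = Halts W (pair (codeList F) (codePair k))

Rel₂ : Set₁
Rel₂ = ℕ → ℕ → Set

apply : EnumOp → Rel₂ → Rel₂
apply W Y a b = ∃ λ (F : List (ℕ × ℕ)) → ((F , (a , b)) ∈W W) × All (λ p → Y (proj₁ p) (proj₂ p)) F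

-- A partial function, given by its graph: a single-valued relation.
SingleValued : Rel₂ → Set
SingleValued R = ∀ n a b → R n a → R n b → a ≡ b

IsWCD : Rel₂ → (ℕ → ℕ) → Set
IsWCD R g = SingleValued R × (∃ λ N → ∀ n → N ≤ n → R n (g n))

_≤wcf_ : (ℕ → ℕ) → (ℕ → ℕ) → Set₁
h ≤wcf g = Σ EnumOp λ W → ∀ (R : Rel₂) → IsWCD R g → IsWCD (apply W R) h

-- Let Φ compute h from g with use tending to infinity. The enumeration
-- operator W runs Φ on input n without an oracle, answering each query q by
-- searching a finite table F for a pair (q , v), and enumerates (F , (n , b))
-- when this run outputs b. If f is a weak cofinite description of g, two
-- tables F₁, F₂ ⊆ gra f give the same answer to every query they both answer,
-- since f is single-valued, so the two runs output the same value: W^{gra f}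
-- is single-valued. For n large, every query of Φ^g(n) lies beyond the point
-- from which f agrees with g, so the table of g on those queries is contained
-- in gra f and yields (n , h n) ∈ W^{gra f}.
module Submission where

open import Defs
open import Data.Nat using (ℕ; zero; suc; _+_; _∸_; _≤_; _<_; z≤n; s≤s; pred; ∣_-_∣)
open import Data.Nat.Properties
open import Data.Fin as Fin using (Fin; inject₁; fromℕ)
open import Data.Vec using (Vec; []; _∷_; lookup; _∷ʳ_)
open import Data.List using (List; []; _∷_; map; drop)
open import Data.List.Properties using (drop-drop)
open import Data.List.Relation.Unary.All as All using (All; []; _∷_)
open import Data.List.Relation.Unary.All.Properties using (++⁻; map⁺)
open import Data.List.Relation.Unary.Any using (here; there)
open import Data.List.Membership.Propositional using (_∈_)
open import Data.List.Membership.Propositional.Properties using (∈-map⁺)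
open import Data.Product using (∃; ∃₂; _×_; _,_; proj₁; proj₂)
open import Relation.Binary.PropositionalEquality

Eval-functional : ∀ {g n} {c : Code n} {xs v w qs rs} →
                  Eval g c xs v qs → Eval g c xs w rs → v ≡ w
EvalVec-functional : ∀ {g m n} {cs : Vec (Code n) m} {xs ys zs qs rs} →
                     EvalVec g cs xs ys qs → EvalVec g cs xs zs rs → ys ≡ zs
MuSearch-functional : ∀ {g n} {f : Code (suc n)} {xs i k l qs rs} →
                      MuSearch g f xs i k qs → MuSearch g f xs i l rs → k ≡ l
Eval-functional ezer ezer = refl
Eval-functional esucc esucc = refl
Eval-functional eproj eproj = refl
Eval-functional (ecomp a b) (ecomp a′ b′) with EvalVec-functional a a′
... | refl = Eval-functional b b′
Eval-functional (eprec0 a) (eprec0 a′) = Eval-functional a a′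
Eval-functional (eprecS a b) (eprecS a′ b′) with Eval-functional a a′
... | refl = Eval-functional b b′
Eval-functional (emu s) (emu s′) = MuSearch-functional s s′
Eval-functional eorc eorc = refl
EvalVec-functional [] [] = refl
EvalVec-functional (a ∷ as) (a′ ∷ as′) =
  cong₂ _∷_ (Eval-functional a a′) (EvalVec-functional as as′)
MuSearch-functional (found e) (found e′) = refl
MuSearch-functional (found e) (step e′ _) with Eval-functional e e′
... | ()
MuSearch-functional (step e _) (found e′) with Eval-functional e e′
... | ()
MuSearch-functional (step _ s) (step _ s′) = MuSearch-functional s s′

MuSearch-result : ∀ {g n} {f : Code (suc n)} {xs i k qs} →
                  MuSearch g f xs i k qs → ∃ (Eval g f (k ∷ xs) 0)
MuSearch-result (found e) = _ , e
MuSearch-result (step _ s) = MuSearch-result s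

MuSearch-complete : ∀ {g n} {f : Code (suc n)} {xs : Vec ℕ n} (v : ℕ → ℕ) →
                    (∀ j → ∃ (Eval g f (j ∷ xs) (v j))) →
                    ∀ i d → v (i + d) ≡ 0 →
                    ∃₂ λ k qs → k ≤ i + d × v k ≡ 0 × MuSearch g f xs i k qs
MuSearch-complete v eval i d v≡0 with v i in vi | eval i
... | zero  | _ , e = i , _ , m≤m+n i d , vi , found e
... | suc _ | _ , e with d
...   | zero  with () ← trans (sym vi) (subst (λ m → v m ≡ 0) (+-identityʳ i) v≡0)
...   | suc d with MuSearch-complete v eval (suc i) d (subst (λ m → v m ≡ 0) (+-suc i d) v≡0)
...     | k , _ , k≤ , vk≡0 , s = k , _ , subst (k ≤_) (sym (+-suc i d)) k≤ , vk≡0 , step e s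

Eval₀ : ∀ {n} → Code n → Vec ℕ n → ℕ → List ℕ → Set
Eval₀ = Eval (λ _ → 0)

infix 4 _[_]⇓_ _[_]⇓ᵛ_

_[_]⇓_ : ∀ {n} → Code n → Vec ℕ n → ℕ → Set
c [ xs ]⇓ v = ∃ (Eval₀ c xs v)

_[_]⇓ᵛ_ : ∀ {m n} → Vec (Code n) m → Vec ℕ n → Vec ℕ m → Set
cs [ xs ]⇓ᵛ ys = ∃ (EvalVec (λ _ → 0) cs xs ys)

⇓-functional : ∀ {n} {c : Code n} {xs v w} → c [ xs ]⇓ v → c [ xs ]⇓ w → v ≡ w
⇓-functional (_ , a) (_ , b) = Eval-functional a b

⇓-cast : ∀ {n} {c : Code n} {xs v w} → v ≡ w → c [ xs ]⇓ v → c [ xs ]⇓ w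
⇓-cast {c = c} {xs} = subst (c [ xs ]⇓_)

⇓-zer : ∀ {n} {xs : Vec ℕ n} → zer [ xs ]⇓ 0
⇓-zer = _ , ezer

⇓-succ : ∀ {x} → succ [ x ∷ [] ]⇓ suc x
⇓-succ = _ , esucc

⇓-proj : ∀ {n} {xs : Vec ℕ n} {i : Fin n} → proj i [ xs ]⇓ lookup xs i
⇓-proj = _ , eproj

⇓-comp : ∀ {m n} {f : Code m} {cs : Vec (Code n) m} {xs ys v} →
         cs [ xs ]⇓ᵛ ys → f [ ys ]⇓ v → comp f cs [ xs ]⇓ v
⇓-comp (_ , a) (_ , b) = _ , ecomp a b

⇓-prec0 : ∀ {n} {f : Code n} {h : Code (suc (suc n))} {xs v} →
          f [ xs ]⇓ v → prec f h [ 0 ∷ xs ]⇓ v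
⇓-prec0 (_ , a) = _ , eprec0 a

⇓-precS : ∀ {n} {f : Code n} {h : Code (suc (suc n))} {xs y r v} →
          prec f h [ y ∷ xs ]⇓ r → h [ y ∷ r ∷ xs ]⇓ v → prec f h [ suc y ∷ xs ]⇓ v
⇓-precS (_ , a) (_ , b) = _ , eprecS a b

[]ᵛ : ∀ {n} {xs : Vec ℕ n} → [] [ xs ]⇓ᵛ []
[]ᵛ = _ , []

infixr 5 _∷ᵛ_
_∷ᵛ_ : ∀ {m n} {c : Code n} {cs : Vec (Code n) m} {xs y ys} →
       c [ xs ]⇓ y → cs [ xs ]⇓ᵛ ys → (c ∷ cs) [ xs ]⇓ᵛ (y ∷ ys)
(_ , a) ∷ᵛ (_ , as) = _ , (a ∷ as)

π₀ : ∀ {n} → Code (suc n)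
π₀ = proj Fin.zero

π₁ : ∀ {n} → Code (suc (suc n))
π₁ = proj (Fin.suc Fin.zero)

π₂ : ∀ {n} → Code (suc (suc (suc n)))
π₂ = proj (Fin.suc (Fin.suc Fin.zero))

-- Arithmetic and unpairing

addProg : Code 2
addProg = prec π₀ (comp succ (π₁ ∷ []))

addProg-correct : ∀ x y → addProg [ x ∷ y ∷ [] ]⇓ x + y
addProg-correct zero    y = ⇓-prec0 ⇓-proj
addProg-correct (suc x) y =
  ⇓-precS (addProg-correct x y) (⇓-comp (⇓-proj ∷ᵛ []ᵛ) ⇓-succ)

predProg : Code 1
predProg = prec zer π₀

predProg-correct : ∀ x → predProg [ x ∷ [] ]⇓ pred x
predProg-correct zero    = ⇓-prec0 ⇓-zer
predProg-correct (suc x) = ⇓-precS (predProg-correct x) ⇓-proj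

flippedMonusProg : Code 2
flippedMonusProg = prec π₀ (comp predProg (π₁ ∷ []))

flippedMonusProg-correct : ∀ y x → flippedMonusProg [ y ∷ x ∷ [] ]⇓ x ∸ y
flippedMonusProg-correct zero    x = ⇓-prec0 ⇓-proj
flippedMonusProg-correct (suc y) x =
  ⇓-cast (pred[m∸n]≡m∸[1+n] x y)
    (⇓-precS (flippedMonusProg-correct y x)
             (⇓-comp (⇓-proj ∷ᵛ []ᵛ) (predProg-correct (x ∸ y))))

monusProg : Code 2
monusProg = comp flippedMonusProg (π₁ ∷ π₀ ∷ [])

monusProg-correct : ∀ x y → monusProg [ x ∷ y ∷ [] ]⇓ x ∸ y
monusProg-correct x y =
  ⇓-comp (⇓-proj ∷ᵛ ⇓-proj ∷ᵛ []ᵛ) (flippedMonusProg-correct y x)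

∸+∸≡∣-∣ : ∀ x y → (x ∸ y) + (y ∸ x) ≡ ∣ x - y ∣
∸+∸≡∣-∣ zero    zero    = refl
∸+∸≡∣-∣ zero    (suc y) = refl
∸+∸≡∣-∣ (suc x) zero    = +-identityʳ (suc x)
∸+∸≡∣-∣ (suc x) (suc y) = ∸+∸≡∣-∣ x y

distProg : Code 2
distProg = comp addProg (monusProg ∷ comp monusProg (π₁ ∷ π₀ ∷ []) ∷ [])

distProg-correct : ∀ x y → distProg [ x ∷ y ∷ [] ]⇓ ∣ x - y ∣
distProg-correct x y =
  ⇓-cast (∸+∸≡∣-∣ x y)
    (⇓-comp (monusProg-correct x y
             ∷ᵛ ⇓-comp (⇓-proj ∷ᵛ ⇓-proj ∷ᵛ []ᵛ) (monusProg-correct y x)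
             ∷ᵛ []ᵛ)
            (addProg-correct _ _))

triProg : Code 1
triProg = prec zer (comp addProg (comp succ (π₀ ∷ []) ∷ π₁ ∷ []))

triProg-correct : ∀ x → triProg [ x ∷ [] ]⇓ tri x
triProg-correct zero    = ⇓-prec0 ⇓-zer
triProg-correct (suc x) =
  ⇓-precS (triProg-correct x)
    (⇓-comp (⇓-comp (⇓-proj ∷ᵛ []ᵛ) ⇓-succ ∷ᵛ ⇓-proj ∷ᵛ []ᵛ)
            (addProg-correct (suc x) (tri x)))

tri-mono-≤ : ∀ {m n} → m ≤ n → tri m ≤ tri n
tri-mono-≤ z≤n       = z≤n
tri-mono-≤ (s≤s m≤n) = +-mono-≤ (s≤s m≤n) (tri-mono-≤ m≤n)

-- The diagonal a + b of pair a b is the least j with pair a b < tri (suc j).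
diagonalTest : Code 2
diagonalTest = comp monusProg (comp succ (π₁ ∷ []) ∷ comp triProg (comp succ (π₀ ∷ []) ∷ []) ∷ [])

diagonalTest-correct : ∀ j x → diagonalTest [ j ∷ x ∷ [] ]⇓ suc x ∸ tri (suc j)
diagonalTest-correct j x =
  ⇓-comp (⇓-comp (⇓-proj ∷ᵛ []ᵛ) ⇓-succ
          ∷ᵛ ⇓-comp (⇓-comp (⇓-proj ∷ᵛ []ᵛ) ⇓-succ ∷ᵛ []ᵛ) (triProg-correct (suc j))
          ∷ᵛ []ᵛ)
         (monusProg-correct _ _)

pair<tri[1+a+b] : ∀ a b → pair a b < tri (suc (a + b))
pair<tri[1+a+b] a b = s≤s (begin
  tri (a + b) + b       ≤⟨ +-monoʳ-≤ (tri (a + b)) (m≤n+m b a) ⟩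
  tri (a + b) + (a + b) ≡⟨ +-comm (tri (a + b)) (a + b) ⟩
  (a + b) + tri (a + b) ∎)
  where open ≤-Reasoning

j<a+b⇒tri[1+j]≤pair : ∀ a b j → j < a + b → tri (suc j) ≤ pair a b
j<a+b⇒tri[1+j]≤pair a b j j<a+b = ≤-trans (tri-mono-≤ j<a+b) (m≤m+n (tri (a + b)) b)

diagonal-unique : ∀ a b k → k ≤ a + b → suc (pair a b) ∸ tri (suc k) ≡ 0 → k ≡ a + b
diagonal-unique a b k k≤a+b test≡0 = ≤-antisym k≤a+b (≮⇒≥ λ k<a+b →
  <-irrefl refl (≤-trans (m∸n≡0⇒m≤n test≡0) (j<a+b⇒tri[1+j]≤pair a b k k<a+b)))

diagonalProg : Code 1
diagonalProg = mu diagonalTest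

diagonalProg-correct : ∀ a b → diagonalProg [ pair a b ∷ [] ]⇓ a + b
diagonalProg-correct a b
  with MuSearch-complete (λ j → suc (pair a b) ∸ tri (suc j)) (λ j → diagonalTest-correct j (pair a b))
         0 (a + b) (m≤n⇒m∸n≡0 (pair<tri[1+a+b] a b))
... | k , _ , k≤a+b , test≡0 , s =
  _ , emu (subst (λ k → MuSearch _ _ _ 0 k _) (diagonal-unique a b k k≤a+b test≡0) s)

sndProg : Code 1
sndProg = comp monusProg (π₀ ∷ comp triProg (diagonalProg ∷ []) ∷ [])

sndProg-correct : ∀ a b → sndProg [ pair a b ∷ [] ]⇓ b
sndProg-correct a b =
  ⇓-cast (m+n∸m≡n (tri (a + b)) b)
    (⇓-comp (⇓-proj ∷ᵛ ⇓-comp (diagonalProg-correct a b ∷ᵛ []ᵛ) (triProg-correct _) ∷ᵛ []ᵛ)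
            (monusProg-correct _ _))

fstProg : Code 1
fstProg = comp monusProg (diagonalProg ∷ sndProg ∷ [])

fstProg-correct : ∀ a b → fstProg [ pair a b ∷ [] ]⇓ a
fstProg-correct a b =
  ⇓-cast (m+n∸n≡m a b)
    (⇓-comp (diagonalProg-correct a b ∷ᵛ sndProg-correct a b ∷ᵛ []ᵛ) (monusProg-correct _ _))

-- Looking up a key in a coded finite table

Table : Set
Table = List (ℕ × ℕ)

firstEntry : Table → ℕ × ℕ
firstEntry []      = 0 , 0
firstEntry (p ∷ _) = p

∈-drop⁻ : ∀ k {F : Table} {p} → p ∈ drop k F → p ∈ F
∈-drop⁻ zero    p∈F = p∈F
∈-drop⁻ (suc k) {_ ∷ F} p∈F = there (∈-drop⁻ k p∈F)

headProg : Code 1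
headProg = comp fstProg (predProg ∷ [])

headProg-correct : ∀ F → headProg [ codeList F ∷ [] ]⇓ codePair (firstEntry F)
headProg-correct []      = ⇓-comp (predProg-correct 0 ∷ᵛ []ᵛ) (fstProg-correct 0 0)
headProg-correct (p ∷ F) =
  ⇓-comp (predProg-correct _ ∷ᵛ []ᵛ) (fstProg-correct (codePair p) (codeList F))

tailProg : Code 1
tailProg = comp sndProg (predProg ∷ [])

tailProg-correct : ∀ F → tailProg [ codeList F ∷ [] ]⇓ codeList (drop 1 F)
tailProg-correct []      = ⇓-comp (predProg-correct 0 ∷ᵛ []ᵛ) (sndProg-correct 0 0)
tailProg-correct (p ∷ F) =
  ⇓-comp (predProg-correct _ ∷ᵛ []ᵛ) (sndProg-correct (codePair p) (codeList F))

keyProg : Code 1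
keyProg = comp fstProg (headProg ∷ [])

keyProg-correct : ∀ F → keyProg [ codeList F ∷ [] ]⇓ proj₁ (firstEntry F)
keyProg-correct F =
  ⇓-comp (headProg-correct F ∷ᵛ []ᵛ) (fstProg-correct (proj₁ (firstEntry F)) (proj₂ (firstEntry F)))

valueProg : Code 1
valueProg = comp sndProg (headProg ∷ [])

valueProg-correct : ∀ F → valueProg [ codeList F ∷ [] ]⇓ proj₂ (firstEntry F)
valueProg-correct F =
  ⇓-comp (headProg-correct F ∷ᵛ []ᵛ) (sndProg-correct (proj₁ (firstEntry F)) (proj₂ (firstEntry F)))

dropProg : Code 2
dropProg = prec π₀ (comp tailProg (π₁ ∷ []))

dropProg-correct : ∀ k F → dropProg [ k ∷ codeList F ∷ [] ]⇓ codeList (drop k F)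
dropProg-correct zero    F = ⇓-prec0 ⇓-proj
dropProg-correct (suc k) F =
  ⇓-cast (cong codeList (trans (drop-drop k 1 F) (cong (λ m → drop m F) (+-comm k 1))))
    (⇓-precS (dropProg-correct k F) (⇓-comp (⇓-proj ∷ᵛ []ᵛ) (tailProg-correct (drop k F))))

isZero : ℕ → ℕ
isZero zero    = 1
isZero (suc _) = 0

isZeroProg : Code 1
isZeroProg = prec (comp succ (zer ∷ [])) zer

isZeroProg-correct : ∀ x → isZeroProg [ x ∷ [] ]⇓ isZero x
isZeroProg-correct zero    = ⇓-prec0 (⇓-comp (⇓-zer ∷ᵛ []ᵛ) ⇓-succ)
isZeroProg-correct (suc x) = ⇓-precS (isZeroProg-correct x) ⇓-zer

-- The isZero term stops the junk entry firstEntry [] = (0 , 0) from matching q = 0.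
mismatch : Table → ℕ → ℕ
mismatch F q = isZero (codeList F) + ∣ proj₁ (firstEntry F) - q ∣

mismatch≡0⇒ : ∀ F q → mismatch F q ≡ 0 → firstEntry F ∈ F × proj₁ (firstEntry F) ≡ q
mismatch≡0⇒ (p ∷ F) q eq = here refl , ∣m-n∣≡0⇒m≡n eq

mismatch-vanishes : ∀ {F q v} → (q , v) ∈ F → ∃ λ k → mismatch (drop k F) q ≡ 0
mismatch-vanishes {q = q} (here refl) = 0 , ∣n-n∣≡0 q
mismatch-vanishes (there q∈F) with k , eq ← mismatch-vanishes q∈F = suc k , eq

mismatchProg : Code 3
mismatchProg = comp addProg (comp isZeroProg (remainder ∷ [])
                             ∷ comp distProg (comp keyProg (remainder ∷ []) ∷ π₁ ∷ [])
                             ∷ [])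
  where
  remainder : Code 3
  remainder = comp dropProg (π₀ ∷ π₂ ∷ [])

mismatchProg-correct : ∀ k q F → mismatchProg [ k ∷ q ∷ codeList F ∷ [] ]⇓ mismatch (drop k F) q
mismatchProg-correct k q F =
  ⇓-comp (⇓-comp (remainder ∷ᵛ []ᵛ) (isZeroProg-correct _)
          ∷ᵛ ⇓-comp (⇓-comp (remainder ∷ᵛ []ᵛ) (keyProg-correct _) ∷ᵛ ⇓-proj ∷ᵛ []ᵛ)
                    (distProg-correct _ _)
          ∷ᵛ []ᵛ)
         (addProg-correct _ _)
  where
  remainder = ⇓-comp (⇓-proj ∷ᵛ ⇓-proj ∷ᵛ []ᵛ) (dropProg-correct k F)

lookupProg : Code 2
lookupProg = comp valueProg (comp dropProg (mu mismatchProg ∷ π₁ ∷ []) ∷ [])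

mismatchProg-search : ∀ {F q v} → (q , v) ∈ F →
                      ∃₂ λ k qs → mismatch (drop k F) q ≡ 0 ×
                                  MuSearch (λ _ → 0) mismatchProg (q ∷ codeList F ∷ []) 0 k qs
mismatchProg-search {F} {q} qv∈F =
  let k₀ , vanishes = mismatch-vanishes qv∈F
      k , qs , _ , mismatch≡0 , s = MuSearch-complete (λ k → mismatch (drop k F) q)
                                      (λ k → mismatchProg-correct k q F) 0 k₀ vanishes
  in k , qs , mismatch≡0 , s

lookupProg-complete : ∀ (g : ℕ → ℕ) {F q} → All (λ p → proj₂ p ≡ g (proj₁ p)) F →
                      (q , g q) ∈ F → lookupProg [ q ∷ codeList F ∷ [] ]⇓ g q
lookupProg-complete g {F} {q} F⊆graph qgq∈F =
  let k , _ , mismatch≡0 , s = mismatchProg-search qgq∈F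
      entry∈ , key≡q = mismatch≡0⇒ (drop k F) q mismatch≡0
  in ⇓-cast (trans (All.lookup F⊆graph (∈-drop⁻ k entry∈)) (cong g key≡q))
       (⇓-comp (⇓-comp ((_ , emu s) ∷ᵛ ⇓-proj ∷ᵛ []ᵛ) (dropProg-correct k F) ∷ᵛ []ᵛ)
               (valueProg-correct (drop k F)))

lookupProg-sound : ∀ F {q y} → lookupProg [ q ∷ codeList F ∷ [] ]⇓ y → (q , y) ∈ F
lookupProg-sound F {q} (_ , ecomp (ecomp (emu {k = k} s ∷ (eproj ∷ [])) dropped ∷ []) value) =
  let entry∈ , key≡q = mismatch≡0⇒ (drop k F) q
                         (sym (⇓-functional (MuSearch-result s) (mismatchProg-correct k q F)))
      dropped≡ = ⇓-functional (_ , dropped) (dropProg-correct k F)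
      value≡ = ⇓-functional (valueProg-correct (drop k F))
                 (subst (λ r → valueProg [ r ∷ [] ]⇓ _) dropped≡ (_ , value))
  in subst (_∈ F) (cong₂ _,_ key≡q value≡) (∈-drop⁻ k entry∈)

-- Replacing the oracle by a program reading an extra last argument

lookup-∷ʳ-inject₁ : ∀ {n} (xs : Vec ℕ n) t (i : Fin n) → lookup (xs ∷ʳ t) (inject₁ i) ≡ lookup xs i
lookup-∷ʳ-inject₁ (x ∷ xs) t Fin.zero    = refl
lookup-∷ʳ-inject₁ (x ∷ xs) t (Fin.suc i) = lookup-∷ʳ-inject₁ xs t i

lookup-∷ʳ-last : ∀ {n} (xs : Vec ℕ n) t → lookup (xs ∷ʳ t) (fromℕ n) ≡ t
lookup-∷ʳ-last []       t = refl
lookup-∷ʳ-last (x ∷ xs) t = lookup-∷ʳ-last xs t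

module Relativize (L : Code 2) where

  relativize : ∀ {n} → Code n → Code (suc n)
  relativizeVec : ∀ {m n} → Vec (Code n) m → Vec (Code (suc n)) m
  relativize zer         = zer
  relativize succ        = comp succ (π₀ ∷ [])
  relativize (proj i)    = proj (inject₁ i)
  relativize {n} (comp f cs) = comp (relativize f) (relativizeVec cs ∷ʳ proj (fromℕ n))
  relativize (prec f h)  = prec (relativize f) (relativize h)
  relativize (mu f)      = mu (relativize f)
  relativize orc         = L
  relativizeVec []       = []
  relativizeVec (c ∷ cs) = relativize c ∷ relativizeVec cs

  module _ {g : ℕ → ℕ} {t : ℕ} where

    Answers : List ℕ → Set
    Answers = All (λ q → L [ q ∷ t ∷ [] ]⇓ g q)

    relativize-complete : ∀ {n} {c : Code n} {xs v qs} →
                          Eval g c xs v qs → Answers qs → relativize c [ xs ∷ʳ t ]⇓ v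
    relativizeVec-complete : ∀ {m n} {cs : Vec (Code n) m} {xs ys qs} →
                             EvalVec g cs xs ys qs → Answers qs →
                             (relativizeVec cs ∷ʳ proj (fromℕ n)) [ xs ∷ʳ t ]⇓ᵛ (ys ∷ʳ t)
    relativizeMu-complete : ∀ {n} {f : Code (suc n)} {xs i k qs} →
                            MuSearch g f xs i k qs → Answers qs →
                            ∃ (MuSearch (λ _ → 0) (relativize f) (xs ∷ʳ t) i k)
    relativize-complete ezer _ = ⇓-zer
    relativize-complete esucc _ = ⇓-comp (⇓-proj ∷ᵛ []ᵛ) ⇓-succ
    relativize-complete (eproj {xs = xs} {i = i}) _ = ⇓-cast (lookup-∷ʳ-inject₁ xs t i) ⇓-proj
    relativize-complete (ecomp {qs = qs} a b) ans with ans₁ , ans₂ ← ++⁻ qs ans =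
      ⇓-comp (relativizeVec-complete a ans₁) (relativize-complete b ans₂)
    relativize-complete (eprec0 a) ans = ⇓-prec0 (relativize-complete a ans)
    relativize-complete (eprecS {qs = qs} a b) ans with ans₁ , ans₂ ← ++⁻ qs ans =
      ⇓-precS (relativize-complete a ans₁) (relativize-complete b ans₂)
    relativize-complete (emu s) ans with _ , s′ ← relativizeMu-complete s ans = _ , emu s′
    relativize-complete eorc (answer ∷ []) = answer
    relativizeVec-complete ([] {xs = xs}) _ =
      ⇓-cast (lookup-∷ʳ-last xs t) ⇓-proj ∷ᵛ []ᵛ
    relativizeVec-complete (_∷_ {qs = qs} a as) ans with ans₁ , ans₂ ← ++⁻ qs ans =
      relativize-complete a ans₁ ∷ᵛ relativizeVec-complete as ans₂
    relativizeMu-complete (found e) ans with _ , e′ ← relativize-complete e ans = _ , found e′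
    relativizeMu-complete (step {qs = qs} e s) ans with ans₁ , ans₂ ← ++⁻ qs ans
      with _ , e′ ← relativize-complete e ans₁ | _ , s′ ← relativizeMu-complete s ans₂ =
      _ , step e′ s′

  module _ {t₁ t₂ : ℕ}
           (agree : ∀ {q y₁ y₂} → L [ q ∷ t₁ ∷ [] ]⇓ y₁ → L [ q ∷ t₂ ∷ [] ]⇓ y₂ → y₁ ≡ y₂)
           where

    relativize-consistent : ∀ {n} (c : Code n) {xs v₁ v₂ qs₁ qs₂} →
                            Eval₀ (relativize c) (xs ∷ʳ t₁) v₁ qs₁ →
                            Eval₀ (relativize c) (xs ∷ʳ t₂) v₂ qs₂ → v₁ ≡ v₂
    relativizeVec-consistent : ∀ {m n} (cs : Vec (Code n) m) {xs ys₁ ys₂ qs₁ qs₂} →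
      EvalVec (λ _ → 0) (relativizeVec cs ∷ʳ proj (fromℕ n)) (xs ∷ʳ t₁) ys₁ qs₁ →
      EvalVec (λ _ → 0) (relativizeVec cs ∷ʳ proj (fromℕ n)) (xs ∷ʳ t₂) ys₂ qs₂ →
      ∃ λ zs → ys₁ ≡ zs ∷ʳ t₁ × ys₂ ≡ zs ∷ʳ t₂
    relativizeMu-consistent : ∀ {n} (f : Code (suc n)) {xs i k₁ k₂ qs₁ qs₂} →
      MuSearch (λ _ → 0) (relativize f) (xs ∷ʳ t₁) i k₁ qs₁ →
      MuSearch (λ _ → 0) (relativize f) (xs ∷ʳ t₂) i k₂ qs₂ → k₁ ≡ k₂
    relativize-consistent zer ezer ezer = refl
    relativize-consistent succ {_ ∷ []} (ecomp (eproj ∷ []) esucc) (ecomp (eproj ∷ []) esucc) = refl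
    relativize-consistent (proj i) {xs} eproj eproj =
      trans (lookup-∷ʳ-inject₁ xs t₁ i) (sym (lookup-∷ʳ-inject₁ xs t₂ i))
    relativize-consistent (comp f cs) (ecomp a₁ b₁) (ecomp a₂ b₂)
      with _ , refl , refl ← relativizeVec-consistent cs a₁ a₂ = relativize-consistent f b₁ b₂
    relativize-consistent (prec f h) {0 ∷ _} (eprec0 a₁) (eprec0 a₂) = relativize-consistent f a₁ a₂
    relativize-consistent (prec f h) {suc y ∷ xs} (eprecS {r = r} a₁ b₁) (eprecS a₂ b₂)
      with refl ← relativize-consistent (prec f h) {y ∷ xs} a₁ a₂ =
      relativize-consistent h {y ∷ r ∷ xs} b₁ b₂
    relativize-consistent (mu f) (emu s₁) (emu s₂) = relativizeMu-consistent f s₁ s₂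
    relativize-consistent orc {_ ∷ []} e₁ e₂ = agree (_ , e₁) (_ , e₂)
    relativizeVec-consistent [] {xs} (eproj ∷ []) (eproj ∷ []) =
      [] , cong (_∷ []) (lookup-∷ʳ-last xs t₁) , cong (_∷ []) (lookup-∷ʳ-last xs t₂)
    relativizeVec-consistent (c ∷ cs) (a₁ ∷ as₁) (a₂ ∷ as₂)
      with refl ← relativize-consistent c a₁ a₂
      with zs , refl , refl ← relativizeVec-consistent cs as₁ as₂ = _ ∷ zs , refl , refl
    relativizeMu-consistent f (found _) (found _) = refl
    relativizeMu-consistent f {xs} {i} (found e₁) (step e₂ _)
      with () ← relativize-consistent f {i ∷ xs} e₁ e₂
    relativizeMu-consistent f {xs} {i} (step e₁ _) (found e₂)
      with () ← relativize-consistent f {i ∷ xs} e₁ e₂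
    relativizeMu-consistent f (step _ s₁) (step _ s₂) = relativizeMu-consistent f s₁ s₂

secondOfTripleProg : Code 1
secondOfTripleProg = comp fstProg (sndProg ∷ [])

secondOfTripleProg-correct : ∀ t a b → secondOfTripleProg [ pair t (pair a b) ∷ [] ]⇓ a
secondOfTripleProg-correct t a b = ⇓-comp (sndProg-correct t (pair a b) ∷ᵛ []ᵛ) (fstProg-correct a b)

thirdOfTripleProg : Code 1
thirdOfTripleProg = comp sndProg (sndProg ∷ [])

thirdOfTripleProg-correct : ∀ t a b → thirdOfTripleProg [ pair t (pair a b) ∷ [] ]⇓ b
thirdOfTripleProg-correct t a b = ⇓-comp (sndProg-correct t (pair a b) ∷ᵛ []ᵛ) (sndProg-correct a b)

graphEnumerator : Code 2 → EnumOp
graphEnumerator P = mu (comp distProg (comp P (onInput secondOfTripleProg ∷ onInput fstProg ∷ [])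
                                       ∷ onInput thirdOfTripleProg ∷ []))
  where
  onInput : Code 1 → Code 2
  onInput c = comp c (π₁ ∷ [])

graphEnumerator-halts : ∀ P {t a b} → P [ a ∷ t ∷ [] ]⇓ b →
                        Halts (graphEnumerator P) (pair t (pair a b))
graphEnumerator-halts P {t} {a} {b} P⇓b =
  let _ , test = ⇓-cast (∣n-n∣≡0 b)
        (⇓-comp (⇓-comp (⇓-comp (⇓-proj ∷ᵛ []ᵛ) (secondOfTripleProg-correct t a b)
                         ∷ᵛ ⇓-comp (⇓-proj ∷ᵛ []ᵛ) (fstProg-correct t (pair a b)) ∷ᵛ []ᵛ) P⇓b
                 ∷ᵛ ⇓-comp (⇓-proj ∷ᵛ []ᵛ) (thirdOfTripleProg-correct t a b) ∷ᵛ []ᵛ)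
                (distProg-correct b b))
  in _ , _ , emu (found test)

graphEnumerator-halts⁻¹ : ∀ P {t a b} → Halts (graphEnumerator P) (pair t (pair a b)) →
                          P [ a ∷ t ∷ [] ]⇓ b
graphEnumerator-halts⁻¹ P {t} {a} {b} (_ , _ , emu s) with MuSearch-result s
... | _ , ecomp (ecomp (ecomp (eproj ∷ []) argument ∷ (ecomp (eproj ∷ []) table ∷ [])) P⇓
                 ∷ (ecomp (eproj ∷ []) value ∷ [])) dist =
  let argument≡a = ⇓-functional (_ , argument) (secondOfTripleProg-correct t a b)
      table≡t    = ⇓-functional (_ , table) (fstProg-correct t (pair a b))
      value≡b    = ⇓-functional (_ , value) (thirdOfTripleProg-correct t a b)
      output≡b   = ∣m-n∣≡0⇒m≡n (⇓-functional (distProg-correct _ _) (_ , dist))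
  in subst₂ (λ x y → P [ x ∷ y ∷ [] ]⇓ b) argument≡a table≡t
       (⇓-cast (trans output≡b value≡b) (_ , P⇓))

-- The enumeration operator built from a Turing functional

open Relativize lookupProg

tableOperator : TuringFunctional → EnumOp
tableOperator Φ = graphEnumerator (relativize Φ)

tableOperator-singleValued : ∀ Φ {R} → SingleValued R → SingleValued (apply (tableOperator Φ) R)
tableOperator-singleValued Φ {R} R-sv n b₁ b₂ (F₁ , halts₁ , F₁⊆R) (F₂ , halts₂ , F₂⊆R)
  with _ , run₁ ← graphEnumerator-halts⁻¹ (relativize Φ) halts₁
     | _ , run₂ ← graphEnumerator-halts⁻¹ (relativize Φ) halts₂
  = relativize-consistent answersAgree Φ {n ∷ []} run₁ run₂
  where
  answersAgree : ∀ {q y₁ y₂} → lookupProg [ q ∷ codeList F₁ ∷ [] ]⇓ y₁ →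
                 lookupProg [ q ∷ codeList F₂ ∷ [] ]⇓ y₂ → y₁ ≡ y₂
  answersAgree l₁ l₂ = R-sv _ _ _ (All.lookup F₁⊆R (lookupProg-sound F₁ l₁))
                                  (All.lookup F₂⊆R (lookupProg-sound F₂ l₂))

graphOn : (ℕ → ℕ) → List ℕ → Table
graphOn g = map (λ q → q , g q)

tableOperator-complete : ∀ Φ {g R n v qs} → Eval g Φ (n ∷ []) v qs →
                         All (λ q → R q (g q)) qs → apply (tableOperator Φ) R n v
tableOperator-complete Φ {g} {qs = qs} run R-on-queries =
  graphOn g qs ,
  graphEnumerator-halts (relativize Φ) (relativize-complete run (All.tabulate answer)) ,
  map⁺ R-on-queries
  where
  answer : ∀ {q} → q ∈ qs → lookupProg [ q ∷ codeList (graphOn g qs) ∷ [] ]⇓ g q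
  answer q∈qs = lookupProg-complete g (map⁺ (All.universal (λ _ → refl) qs))
                                      (∈-map⁺ (λ q → q , g q) q∈qs)

proposition4p5 : (g h : ℕ → ℕ) → h ≤ubfb g → h ≤wcf g
proposition4p5 g h (Φ , computes , useToInfinity) =
  tableOperator Φ , λ R (R-sv , N₀ , R-cofinite) →
    tableOperator-singleValued Φ R-sv ,
    let N , useBeyondN₀ = useToInfinity N₀ in
    N , λ n N≤n → let qs , run = computes n in
      tableOperator-complete Φ run (All.map (R-cofinite _) (useBeyondN₀ n N≤n qs run))
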